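{- Let $M$ be a matroid and let $Z$ be a cyclic flat of $M$. If a subset $U$ of $Z$ with $|U|\ge\eta(Z)$ is contained in every nonempty cyclic flat of $M$ that is contained in $Z$, then $Z-U$ is independent in $M$.
   Context: All matroids are finite. A cyclic set is a (possibly empty) union of circuits; a cyclic flat is a flat that is a cyclic set. The nullity of a set $Y$ is $\eta(Y)=|Y|-r(Y)$. -}

module Defs where

open import Data.Nat using (ℕ; _+_; _∸_; _≤_)
open import Data.Fin using (Fin)
open import Data.Fin.Subset using (Subset; _⊆_; _⊂_; _∪_; _∩_; ∣_∣; _∈_; _∉_; ⁅_⁆)
open import Data.Product using (Σ; _×_)
open import Relation.Nullary using (¬_)
open import Relation.Binary.PropositionalEquality using (_≡_; _≢_)

record Matroid (n : ℕ) : Set where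
  field
    r         : Subset n → ℕ
    r-bounded : ∀ X → r X ≤ ∣ X ∣
    r-mono    : ∀ {X Y} → X ⊆ Y → r X ≤ r Y
    r-submod  : ∀ X Y → r (X ∪ Y) + r (X ∩ Y) ≤ r X + r Y

module _ {n : ℕ} (M : Matroid n) where
  open Matroid M

  Independent : Subset n → Set
  Independent X = r X ≡ ∣ X ∣

  Dependent : Subset n → Set
  Dependent X = ¬ Independent X

  Circuit : Subset n → Set
  Circuit C = Dependent C × (∀ D → D ⊂ C → Independent D)

  -- cyclic set: a (possibly empty) union of circuits, i.e. every element
  -- of Y lies in some circuit contained in Y
  Cyclic : Subset n → Set
  Cyclic Y = ∀ x → x ∈ Y → Σ (Subset n) (λ C → Circuit C × C ⊆ Y × x ∈ C)

  Flat : Subset n → Set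
  Flat F = ∀ x → x ∉ F → r (F ∪ ⁅ x ⁆) ≢ r F

  CyclicFlat : Subset n → Set
  CyclicFlat F = Cyclic F × Flat F

  η : Subset n → ℕ
  η Y = ∣ Y ∣ ∸ r Y

module Submission where

-- Let X = Z ─ U.  If X is dependent it contains a circuit C.  The closure
-- cl C is a nonempty cyclic flat, and it lies inside the flat Z; by the
-- hypothesis U ⊆ cl C, so every element of U is spanned by C and hence by X.
-- Therefore r Z = r X, and counting gives
--   ∣ X ∣ = ∣ Z ∣ - ∣ U ∣ ≤ ∣ Z ∣ - η Z = r Z = r X,
-- i.e. X is independent after all.

open import Defs
open import Data.Nat using (ℕ; zero; suc; _+_; _≤_; _<_; _≤ᵇ_)
open import Data.Nat.Properties
  using (≤-refl; ≤-trans; ≤-antisym; ≤-pred; n≮0; n≤0⇒n≡0; m≤m+n;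
         m≤n+m∸n; +-mono-≤; +-monoˡ-≤; +-monoʳ-≤; +-cancelˡ-≤; +-cancelʳ-≤;
         +-suc; ≤ᵇ⇒≤; ≤⇒≤ᵇ; _≟_; module ≤-Reasoning)
open import Data.Fin using (Fin)
import Data.Fin as Fin
open import Data.Fin.Properties using (any?)
open import Data.Fin.Subset
  using (Subset; _⊆_; _⊂_; _∪_; _∩_; _─_; _-_; ⁅_⁆; ∣_∣; _∈_; _∉_; ⊥; Nonempty)
open import Data.Fin.Subset.Properties
  using (p⊆p∪q; q⊆p∪q; x∈p∪q⁻; x∈p∩q⁺; p─q⊆p; x∈p∧x∉q⇒x∈p─q;
         x∈p∧x≢y⇒x∈p-y; x∈⁅x⁆; x∈⁅y⁆⇒x≡y; ∣⁅x⁆∣≡1; ∣⊥∣≡0; x∈p⇒∣p-x∣<∣p∣; x∈p⇒p-x⊂p;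
         ⊆-trans; ⊆-⊂-trans; drop-∷-⊆; nonempty?; Empty-unique; p⊆q⇒∣p∣≤∣q∣; _∈?_)
open import Data.Bool using (true; false)
open import Data.Bool.Properties using (T-≡)
open import Data.Vec using ([]; _∷_; here; tabulate)
open import Data.Vec.Properties using (lookup∘tabulate; []=⇒lookup; lookup⇒[]=)
open import Data.Product using (Σ; _×_; _,_)
open import Data.Sum using (inj₁; inj₂)
open import Function.Bundles using (Equivalence)
open import Relation.Nullary using (Dec; yes; no; contradiction)
open import Relation.Binary.PropositionalEquality
  using (_≡_; refl; sym; trans; cong; subst)

open Equivalence using (to; from)

∣p─q∣+∣q∣≡∣p∣ : ∀ {n} (p q : Subset n) → q ⊆ p → ∣ p ─ q ∣ + ∣ q ∣ ≡ ∣ p ∣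
∣p─q∣+∣q∣≡∣p∣ []          []          _   = refl
∣p─q∣+∣q∣≡∣p∣ (true  ∷ p) (false ∷ q) q⊆p = cong suc (∣p─q∣+∣q∣≡∣p∣ p q (drop-∷-⊆ q⊆p))
∣p─q∣+∣q∣≡∣p∣ (false ∷ p) (false ∷ q) q⊆p = ∣p─q∣+∣q∣≡∣p∣ p q (drop-∷-⊆ q⊆p)
∣p─q∣+∣q∣≡∣p∣ (true  ∷ p) (true  ∷ q) q⊆p =
  trans (+-suc ∣ p ─ q ∣ ∣ q ∣) (cong suc (∣p─q∣+∣q∣≡∣p∣ p q (drop-∷-⊆ q⊆p)))
∣p─q∣+∣q∣≡∣p∣ (false ∷ p) (true  ∷ q) q⊆p with q⊆p here
... | ()

⁅x⁆⊆ : ∀ {n} {x : Fin n} {p : Subset n} → x ∈ p → ⁅ x ⁆ ⊆ p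
⁅x⁆⊆ {p = p} x∈p y∈⁅x⁆ = subst (_∈ p) (sym (x∈⁅y⁆⇒x≡y _ y∈⁅x⁆)) x∈p

∣p-x∣+1≡∣p∣ : ∀ {n} {x : Fin n} (p : Subset n) → x ∈ p → ∣ p - x ∣ + 1 ≡ ∣ p ∣
∣p-x∣+1≡∣p∣ {x = x} p x∈p =
  trans (cong (∣ p - x ∣ +_) (sym (∣⁅x⁆∣≡1 x))) (∣p─q∣+∣q∣≡∣p∣ p ⁅ x ⁆ (⁅x⁆⊆ x∈p))

-- A removed element can be used as fuel: it shrinks a size bound by one.
∣p-x∣<bound : ∀ {n k} {x : Fin n} {p : Subset n} → x ∈ p → ∣ p ∣ ≤ k → ∣ p - x ∣ < k
∣p-x∣<bound x∈p bound = ≤-trans (x∈p⇒∣p-x∣<∣p∣ x∈p) bound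

∪-⊆ : ∀ {n} {p q s : Subset n} → p ⊆ s → q ⊆ s → p ∪ q ⊆ s
∪-⊆ {p = p} {q} p⊆s q⊆s x∈p∪q with x∈p∪q⁻ p q x∈p∪q
... | inj₁ x∈p = p⊆s x∈p
... | inj₂ x∈q = q⊆s x∈q

p⊆p─q∪q : ∀ {n} (p q : Subset n) → p ⊆ (p ─ q) ∪ q
p⊆p─q∪q p q {x} x∈p with x ∈? q
... | yes x∈q = q⊆p∪q (p ─ q) q x∈q
... | no  x∉q = p⊆p∪q q (x∈p∧x∉q⇒x∈p─q x∈p x∉q)

⊆-remove : ∀ {n} {x : Fin n} {p q : Subset n} → p ⊆ q → x ∉ p → p ⊆ q - x
⊆-remove {x = x} p⊆q x∉p {y} y∈p with y Fin.≟ x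
... | yes refl = contradiction y∈p x∉p
... | no  y≢x  = x∈p∧x≢y⇒x∈p-y (p⊆q y∈p) y≢x

module _ {n : ℕ} (M : Matroid n) where
  open Matroid M

  diminishing-returns : ∀ {A B} S → A ⊆ B → r (B ∪ S) + r A ≤ r B + r (A ∪ S)
  diminishing-returns {A} {B} S A⊆B =
    ≤-trans (+-mono-≤ (r-mono B∪S⊆) (r-mono A⊆)) (r-submod B (A ∪ S))
    where
    B∪S⊆ : B ∪ S ⊆ B ∪ (A ∪ S)
    B∪S⊆ = ∪-⊆ (p⊆p∪q (A ∪ S)) (⊆-trans (q⊆p∪q A S) (q⊆p∪q B (A ∪ S)))
    A⊆ : A ⊆ B ∩ (A ∪ S)
    A⊆ x∈A = x∈p∩q⁺ (A⊆B x∈A , p⊆p∪q S x∈A)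

  rank-union-≤ : ∀ X Y → r (X ∪ Y) ≤ ∣ X ∣ + r Y
  rank-union-≤ X Y =
    ≤-trans (m≤m+n (r (X ∪ Y)) (r (X ∩ Y)))
            (≤-trans (r-submod X Y) (+-monoˡ-≤ (r Y) (r-bounded X)))

  Spans : Subset n → Fin n → Set
  Spans Y x = r (Y ∪ ⁅ x ⁆) ≤ r Y

  spans-member : ∀ {Y x} → x ∈ Y → Spans Y x
  spans-member x∈Y = r-mono (∪-⊆ (λ y∈Y → y∈Y) (⁅x⁆⊆ x∈Y))

  spans-mono : ∀ {C Y x} → C ⊆ Y → Spans C x → Spans Y x
  spans-mono {C} {Y} {x} C⊆Y C-spans =
    +-cancelʳ-≤ (r C) (r (Y ∪ ⁅ x ⁆)) (r Y)
      (≤-trans (diminishing-returns ⁅ x ⁆ C⊆Y) (+-monoʳ-≤ (r Y) C-spans))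

  spans-all : ∀ Y A → (∀ {x} → x ∈ A → Spans Y x) → r (Y ∪ A) ≤ r Y
  spans-all Y A = go ∣ A ∣ A ≤-refl
    where
    go : ∀ k A → ∣ A ∣ ≤ k → (∀ {x} → x ∈ A → Spans Y x) → r (Y ∪ A) ≤ r Y
    go k A _ spanned with nonempty? A
    go k A _ spanned | no A-empty =
      r-mono (∪-⊆ (λ y∈Y → y∈Y) λ {x} x∈A → contradiction (x , x∈A) A-empty)
    go zero A bound spanned | yes (x , x∈A) = contradiction (∣p-x∣<bound x∈A bound) n≮0
    go (suc k) A bound spanned | yes (x , x∈A) = begin
      r (Y ∪ A)                   ≤⟨ r-mono Y∪A⊆ ⟩
      r ((Y ∪ (A - x)) ∪ ⁅ x ⁆)   ≤⟨ spans-mono (p⊆p∪q (A - x)) (spanned x∈A) ⟩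
      r (Y ∪ (A - x))             ≤⟨ go k (A - x) (≤-pred (∣p-x∣<bound x∈A bound))
                                         (λ y∈A-x → spanned (p─q⊆p A ⁅ x ⁆ y∈A-x)) ⟩
      r Y                         ∎
      where
      open ≤-Reasoning
      Y∪A⊆ : Y ∪ A ⊆ (Y ∪ (A - x)) ∪ ⁅ x ⁆
      Y∪A⊆ = ∪-⊆ (⊆-trans (p⊆p∪q (A - x)) (p⊆p∪q ⁅ x ⁆))
                 (⊆-trans (p⊆p─q∪q A ⁅ x ⁆)
                          (∪-⊆ (⊆-trans (q⊆p∪q Y (A - x)) (p⊆p∪q ⁅ x ⁆))
                               (q⊆p∪q (Y ∪ (A - x)) ⁅ x ⁆)))

  cl : Subset n → Subset n
  cl Y = tabulate (λ x → r (Y ∪ ⁅ x ⁆) ≤ᵇ r Y)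

  cl-spans : ∀ {Y x} → x ∈ cl Y → Spans Y x
  cl-spans {Y} {x} x∈cl = ≤ᵇ⇒≤ _ _ (from T-≡
    (trans (sym (lookup∘tabulate (λ x → r (Y ∪ ⁅ x ⁆) ≤ᵇ r Y) x)) ([]=⇒lookup x∈cl)))

  spans-cl : ∀ {Y x} → Spans Y x → x ∈ cl Y
  spans-cl {Y} {x} Y-spans = lookup⇒[]= x (cl Y)
    (trans (lookup∘tabulate (λ x → r (Y ∪ ⁅ x ⁆) ≤ᵇ r Y) x) (to T-≡ (≤⇒≤ᵇ Y-spans)))

  ⊆-cl : ∀ Y → Y ⊆ cl Y
  ⊆-cl Y x∈Y = spans-cl (spans-member x∈Y)

  r-cl : ∀ Y → r (cl Y) ≤ r Y
  r-cl Y = ≤-trans (r-mono (q⊆p∪q Y (cl Y))) (spans-all Y (cl Y) cl-spans)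

  cl-flat : ∀ Y → Flat M (cl Y)
  cl-flat Y x x∉cl r-equal = x∉cl (spans-cl (begin
    r (Y ∪ ⁅ x ⁆)      ≤⟨ r-mono (∪-⊆ (⊆-trans (⊆-cl Y) (p⊆p∪q ⁅ x ⁆)) (q⊆p∪q (cl Y) ⁅ x ⁆)) ⟩
    r (cl Y ∪ ⁅ x ⁆)   ≡⟨ r-equal ⟩
    r (cl Y)           ≤⟨ r-cl Y ⟩
    r Y                ∎))
    where open ≤-Reasoning

  cl-least : ∀ {C Z} → Flat M Z → C ⊆ Z → cl C ⊆ Z
  cl-least {C} {Z} Z-flat C⊆Z {x} x∈cl with x ∈? Z
  ... | yes x∈Z = x∈Z
  ... | no  x∉Z = contradiction
    (≤-antisym (spans-mono C⊆Z (cl-spans x∈cl)) (r-mono (p⊆p∪q ⁅ x ⁆)))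
    (Z-flat x x∉Z)

  independent? : ∀ X → Dec (Independent M X)
  independent? X = r X ≟ ∣ X ∣

  independent-⊆ : ∀ {A B} → A ⊆ B → Independent M B → Independent M A
  independent-⊆ {A} {B} A⊆B B-indep =
    ≤-antisym (r-bounded A) (+-cancelˡ-≤ ∣ B ─ A ∣ ∣ A ∣ (r A) (begin
      ∣ B ─ A ∣ + ∣ A ∣     ≡⟨ ∣p─q∣+∣q∣≡∣p∣ B A A⊆B ⟩
      ∣ B ∣                 ≡⟨ sym B-indep ⟩
      r B                   ≤⟨ r-mono (p⊆p─q∪q B A) ⟩
      r ((B ─ A) ∪ A)       ≤⟨ rank-union-≤ (B ─ A) A ⟩
      ∣ B ─ A ∣ + r A       ∎))
    where open ≤-Reasoning

  -- The empty set is independent, so circuits are nonempty.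
  circuit-nonempty : ∀ {C} → Circuit M C → Nonempty C
  circuit-nonempty {C} (C-dep , _) with nonempty? C
  ... | yes C-nonempty = C-nonempty
  ... | no  C-empty    = contradiction
    (subst (Independent M) (sym (Empty-unique C-empty)) ⊥-independent) C-dep
    where
    ⊥-independent : Independent M ⊥
    ⊥-independent = trans (n≤0⇒n≡0 (subst (r ⊥ ≤_) (∣⊥∣≡0 n) (r-bounded ⊥)))
                          (sym (∣⊥∣≡0 n))

  -- Every dependent set contains a circuit: remove elements as long as the
  -- result stays dependent; a dependent set that cannot be shrunk is a circuit.
  dependent⇒circuit : ∀ {D} → Dependent M D → Σ (Subset n) λ C → Circuit M C × C ⊆ D
  dependent⇒circuit {D} = go ∣ D ∣ D ≤-refl
    where
    Shrinkable : Subset n → Fin n → Set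
    Shrinkable D x = x ∈ D × Dependent M (D - x)

    shrinkable? : ∀ D x → Dec (Shrinkable D x)
    shrinkable? D x with x ∈? D | independent? (D - x)
    ... | yes x∈D | no  dep   = yes (x∈D , dep)
    ... | yes _   | yes indep = no λ (_ , dep) → dep indep
    ... | no  x∉D | _         = no λ (x∈D , _) → x∉D x∈D

    go : ∀ k D → ∣ D ∣ ≤ k → Dependent M D → Σ (Subset n) λ C → Circuit M C × C ⊆ D
    go k D bound D-dep with any? (shrinkable? D)
    go zero D bound D-dep | yes (x , x∈D , _) = contradiction (∣p-x∣<bound x∈D bound) n≮0
    go (suc k) D bound D-dep | yes (x , x∈D , D-x-dep)
      with go k (D - x) (≤-pred (∣p-x∣<bound x∈D bound)) D-x-dep
    ... | C , C-circuit , C⊆D-x = C , C-circuit , λ y∈C → p─q⊆p D ⁅ x ⁆ (C⊆D-x y∈C)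
    go k D bound D-dep | no unshrinkable = D , (D-dep , minimal) , λ y∈D → y∈D
      where
      minimal : ∀ D' → D' ⊂ D → Independent M D'
      minimal D' (D'⊆D , x , x∈D , x∉D') with independent? (D - x)
      ... | yes D-x-indep = independent-⊆ (⊆-remove D'⊆D x∉D') D-x-indep
      ... | no  D-x-dep   = contradiction (x , x∈D , D-x-dep) unshrinkable

  dependent-exchange : ∀ {C c e} → Dependent M C → c ∈ C → e ∉ C → Spans C e →
                       Dependent M ((C - c) ∪ ⁅ e ⁆)
  dependent-exchange {C} {c} {e} C-dep c∈C e∉C C-spans D-indep =
    C-dep (≤-antisym (r-bounded C) (begin
      ∣ C ∣               ≡⟨ sym (∣p-x∣+1≡∣p∣ C c∈C) ⟩
      ∣ C - c ∣ + 1       ≤⟨ +-monoˡ-≤ 1 (p⊆q⇒∣p∣≤∣q∣ C-c⊆D-e) ⟩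
      ∣ D - e ∣ + 1       ≡⟨ ∣p-x∣+1≡∣p∣ D (q⊆p∪q (C - c) ⁅ e ⁆ (x∈⁅x⁆ e)) ⟩
      ∣ D ∣               ≡⟨ sym D-indep ⟩
      r D                 ≤⟨ r-mono (∪-⊆ (⊆-trans (p─q⊆p C ⁅ c ⁆) (p⊆p∪q ⁅ e ⁆))
                                         (q⊆p∪q C ⁅ e ⁆)) ⟩
      r (C ∪ ⁅ e ⁆)       ≤⟨ C-spans ⟩
      r C                 ∎))
    where
    open ≤-Reasoning
    D : Subset n
    D = (C - c) ∪ ⁅ e ⁆
    C-c⊆D-e : C - c ⊆ D - e
    C-c⊆D-e = ⊆-remove (p⊆p∪q ⁅ e ⁆) λ e∈C-c → e∉C (p─q⊆p C ⁅ c ⁆ e∈C-c)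

  -- The closure of a circuit C is cyclic: an element e ∈ cl C outside C lies
  -- in a circuit inside (C - c) ∪ ⁅ e ⁆ for any c ∈ C, and that circuit must
  -- contain e, since otherwise it would be a proper subset of C.
  cl-circuit-cyclic : ∀ {C} → Circuit M C → Cyclic M (cl C)
  cl-circuit-cyclic {C} C-circuit@(C-dep , C-minimal) e e∈cl with e ∈? C
  ... | yes e∈C = C , C-circuit , ⊆-cl C , e∈C
  ... | no  e∉C with circuit-nonempty C-circuit
  ... | c , c∈C with dependent⇒circuit (dependent-exchange C-dep c∈C e∉C (cl-spans e∈cl))
  ... | C' , C'-circuit@(C'-dep , _) , C'⊆D = C' , C'-circuit , C'⊆cl , e∈C'
    where
    C'⊆cl : C' ⊆ cl C
    C'⊆cl = ⊆-trans C'⊆D (∪-⊆ (⊆-trans (p─q⊆p C ⁅ c ⁆) (⊆-cl C)) (⁅x⁆⊆ e∈cl))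

    e∈C' : e ∈ C'
    e∈C' with e ∈? C'
    ... | yes e∈C' = e∈C'
    ... | no  e∉C' =
      contradiction (C-minimal C' (⊆-⊂-trans C'⊆C-c (x∈p⇒p-x⊂p c∈C))) C'-dep
      where
      C'⊆C-c : C' ⊆ C - c
      C'⊆C-c {y} y∈C' with x∈p∪q⁻ (C - c) ⁅ e ⁆ (C'⊆D y∈C')
      ... | inj₁ y∈C-c = y∈C-c
      ... | inj₂ y∈⁅e⁆ = contradiction (subst (_∈ C') (x∈⁅y⁆⇒x≡y _ y∈⁅e⁆) y∈C') e∉C'

  independent-by-nullity : ∀ {Z U} → U ⊆ Z → η M Z ≤ ∣ U ∣ → r Z ≤ r (Z ─ U) →
                           Independent M (Z ─ U)
  independent-by-nullity {Z} {U} U⊆Z η≤∣U∣ rank-kept =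
    ≤-antisym (r-bounded (Z ─ U))
              (≤-trans (+-cancelʳ-≤ ∣ U ∣ ∣ Z ─ U ∣ (r Z) size-bound) rank-kept)
    where
    open ≤-Reasoning
    size-bound : ∣ Z ─ U ∣ + ∣ U ∣ ≤ r Z + ∣ U ∣
    size-bound = begin
      ∣ Z ─ U ∣ + ∣ U ∣   ≡⟨ ∣p─q∣+∣q∣≡∣p∣ Z U U⊆Z ⟩
      ∣ Z ∣               ≤⟨ m≤n+m∸n ∣ Z ∣ (r Z) ⟩
      r Z + η M Z         ≤⟨ +-monoʳ-≤ (r Z) η≤∣U∣ ⟩
      r Z + ∣ U ∣         ∎

lemma2p3 : ∀ {n : ℕ} (M : Matroid n) (Z U : Subset n) →
    CyclicFlat M Z →
    U ⊆ Z →
    η M Z ≤ ∣ U ∣ →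
    (∀ F → Nonempty F → CyclicFlat M F → F ⊆ Z → U ⊆ F) →
    Independent M (Z ─ U)
lemma2p3 M Z U (_ , Z-flat) U⊆Z η≤∣U∣ U-in-cyclic-flats with independent? M (Z ─ U)
... | yes indep = indep
... | no  dep with dependent⇒circuit M dep
... | C , C-circuit , C⊆Z─U = independent-by-nullity M U⊆Z η≤∣U∣ rank-kept
  where
  open Matroid M using (r; r-mono)
  U⊆clC : U ⊆ cl M C
  U⊆clC = U-in-cyclic-flats (cl M C)
    (let (c , c∈C) = circuit-nonempty M C-circuit in c , ⊆-cl M C c∈C)
    (cl-circuit-cyclic M C-circuit , cl-flat M C)
    (cl-least M Z-flat (⊆-trans C⊆Z─U (p─q⊆p Z U)))
  rank-kept : r Z ≤ r (Z ─ U)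
  rank-kept = ≤-trans (r-mono (p⊆p─q∪q Z U))
    (spans-all M (Z ─ U) U λ u∈U → spans-mono M C⊆Z─U (cl-spans M (U⊆clC u∈U)))
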